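{- Let $q$ be a power of $2$, $n\ge1$ an integer and $\alpha\in\mathbb{F}_q^\times$. Then the projective plane curves over $\mathbb{F}_q$ \[ xy^q+xyz^{q-1}=\alpha x^2z^{q-1}+z^{q+1}\quad\text{and}\quad xy^q+xyz^{q-1}=x^2z^{q-1}+z^{q+1} \] (the projective closures of $x(y^q+y)=\alpha x^2+1$ and $x(y^q+y)=x^2+1$) have the same number of $\mathbb{F}_{q^n}$-rational points.
   Context: Rational points are counted in $\mathbb{P}^2(\mathbb{F}_{q^n})$. -}

module Defs where

open import Level using (0ℓ)
open import Algebra.Bundles using (CommutativeRing)
open import Data.Nat using (ℕ; zero; suc; _∸_)
open import Data.Product using (_×_; ∃; _,_)
open import Data.List using (List; length)
open import Data.List.Relation.Unary.All using (All)
open import Data.List.Relation.Unary.Any using (Any)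
open import Data.List.Relation.Unary.AllPairs using (AllPairs)
open import Relation.Nullary using (¬_)
open import Relation.Binary using (Decidable)

record FiniteField : Set₁ where
  field
    cring : CommutativeRing 0ℓ 0ℓ
  open CommutativeRing cring public
  field
    1≉0      : ¬ (1# ≈ 0#)
    inverse  : ∀ x → ¬ (x ≈ 0#) → ∃ λ y → (x * y) ≈ 1#
    _≟_      : Decidable _≈_
    elements : List Carrier
    complete : ∀ x → Any (x ≈_) elements
    distinct : AllPairs (λ a b → ¬ (a ≈ b)) elements

  card : ℕ
  card = length elements

  _^_ : Carrier → ℕ → Carrier
  x ^ zero  = 1#
  x ^ suc k = x * (x ^ k)

  Triple : Set
  Triple = Carrier × Carrier × Carrier

  NonZero : Triple → Set
  NonZero (x , y , z) = ¬ ((x ≈ 0#) × (y ≈ 0#) × (z ≈ 0#))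

  Proportional : Triple → Triple → Set
  Proportional (x , y , z) (x' , y' , z') =
    ∃ λ t → ¬ (t ≈ 0#) × (x' ≈ t * x) × (y' ≈ t * y) × (z' ≈ t * z)

  -- R is a complete system of representatives of the rational points
  -- of the projective plane curve {C = 0} ⊆ P²(field); its length is the
  -- number of rational points of the curve.
  record IsPointList (C : Triple → Set) (R : List Triple) : Set where
    field
      onCurve     : All (λ p → NonZero p × C p) R
      inequivalent : AllPairs (λ p p' → ¬ Proportional p p') R
      covers      : ∀ p → NonZero p → C p → Any (Proportional p) R

  Curve : ℕ → Carrier → Triple → Set
  Curve q a (x , y , z) =
    ((x * (y ^ q)) + ((x * y) * (z ^ (q ∸ 1))))
      ≈ (((a * (x ^ 2)) * (z ^ (q ∸ 1))) + (z ^ suc q))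

module Submission where

-- The two curves  C_a : x y^q + x y z^(q-1) = a x^2 z^(q-1) + z^(q+1)
-- for a = α and a = 1 are isomorphic over the field itself, so they have the
-- same number of rational points.  Writing q = 2h, the element β = α^h is a
-- square root of α (because α^q = α) which is again fixed by y ↦ y^q, and the
-- diagonal change of coordinates (x , y , z) ↦ (β x , β⁻¹ y , z) maps C_α to
-- C_1; the analogous map built from β⁻¹ and β goes back.
--
-- The theorem lemma4 instantiates this with q = 2^m.

open import Defs
open import Data.Nat using (ℕ; _≤_) renaming (_^_ to _^ℕ_)
open import Data.List using (List; length)
open import Relation.Binary.PropositionalEquality using (_≡_)
open import Relation.Nullary using (¬_)

open import Level using (0ℓ)
open import Data.Nat using (zero; suc; z≤n; s≤s; _∸_) renaming (_*_ to _*ℕ_)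
import Data.Nat.Properties as ℕ
open import Data.Product using (_×_; _,_; proj₁; proj₂)
open import Data.List using (map)
open import Data.List.Properties using (length-map; length-removeAt′)
open import Data.List.Relation.Unary.All as All using (All; []; _∷_)
import Data.List.Relation.Unary.All.Properties as AllProperties
open import Data.List.Relation.Unary.Any using (Any; here; there; index; _─_)
open import Data.List.Relation.Unary.AllPairs as AllPairs using (AllPairs; []; _∷_)
import Data.List.Relation.Unary.AllPairs.Properties as AllPairsProperties
open import Relation.Binary using (Rel; Symmetric; Transitive)
import Relation.Binary.PropositionalEquality as ≡
import Algebra.Properties.CommutativeSemigroup as CommutativeSemigroupProperties
import Algebra.Properties.CommutativeSemiring.Exp as Exp

module Counting {A : Set} (_∼_ : Rel A 0ℓ) (∼-sym : Symmetric _∼_) (∼-trans : Transitive _∼_) where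

  Inequivalent : Rel A 0ℓ
  Inequivalent a b = ¬ (a ∼ b)

  keep-match : ∀ {a b B} → ¬ (a ∼ b) → (a∈B : Any (a ∼_) B) → Any (b ∼_) B →
               Any (b ∼_) (B ─ a∈B)
  keep-match a≁b (here a∼x) (here b∼x) with () ← a≁b (∼-trans a∼x (∼-sym b∼x))
  keep-match a≁b (here _)   (there b∈B) = b∈B
  keep-match a≁b (there _)  (here b∼x)  = here b∼x
  keep-match a≁b (there a∈B) (there b∈B) = there (keep-match a≁b a∈B b∈B)

  -- Each element of the pairwise inequivalent list `as` consumes its own
  -- element of B, so B is at least as long as `as`.
  length-≤ : ∀ {as} B → AllPairs Inequivalent as → All (λ a → Any (a ∼_) B) as →
             length as ≤ length B
  length-≤ B [] [] = z≤n
  length-≤ B (a≁as ∷ as-distinct) (a∈B ∷ as∈B) = ℕ.≤-trans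
    (s≤s (length-≤ (B ─ a∈B) as-distinct
      (All.zipWith (λ (a≁b , b∈B) → keep-match a≁b a∈B b∈B) (a≁as , as∈B))))
    (ℕ.≤-reflexive (≡.sym (length-removeAt′ B (index a∈B))))

module Projective (L : FiniteField) where
  open FiniteField L
  open import Relation.Binary.Reasoning.Setoid setoid
  open CommutativeSemigroupProperties *-commutativeSemigroup
    using (interchange; x∙yz≈y∙xz)
  module Power = Exp commutativeSemiring

  inverse-unique : ∀ {x y y'} → (x * y) ≈ 1# → (x * y') ≈ 1# → y ≈ y'
  inverse-unique {x} {y} {y'} xy≈1 xy'≈1 = begin
    y              ≈⟨ *-identityʳ y ⟨
    y * 1#         ≈⟨ *-congˡ xy'≈1 ⟨
    y * (x * y')   ≈⟨ *-assoc y x y' ⟨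
    (y * x) * y'   ≈⟨ *-congʳ (trans (*-comm y x) xy≈1) ⟩
    1# * y'        ≈⟨ *-identityˡ y' ⟩
    y'             ∎

  unit-≉0 : ∀ {t u} → (t * u) ≈ 1# → ¬ (u ≈ 0#)
  unit-≉0 {t} {u} tu≈1 u≈0 = 1≉0 (begin
    1#      ≈⟨ tu≈1 ⟨
    t * u   ≈⟨ *-congˡ u≈0 ⟩
    t * 0#  ≈⟨ zeroʳ t ⟩
    0#      ∎)

  cancelˡ : ∀ {k c u v} → (k * c) ≈ 1# → (c * u) ≈ (c * v) → u ≈ v
  cancelˡ {k} {c} {u} {v} kc≈1 cu≈cv = begin
    u            ≈⟨ *-identityˡ u ⟨
    1# * u       ≈⟨ *-congʳ kc≈1 ⟨
    (k * c) * u  ≈⟨ *-assoc k c u ⟩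
    k * (c * u)  ≈⟨ *-congˡ cu≈cv ⟩
    k * (c * v)  ≈⟨ *-assoc k c v ⟨
    (k * c) * v  ≈⟨ *-congʳ kc≈1 ⟩
    1# * v       ≈⟨ *-identityˡ v ⟩
    v            ∎

  unit-cancels : ∀ {c d} → (c * d) ≈ 1# → ∀ u v → ((c * u) * (d * v)) ≈ (u * v)
  unit-cancels {c} {d} cd≈1 u v = begin
    (c * u) * (d * v)  ≈⟨ interchange c u d v ⟩
    (c * d) * (u * v)  ≈⟨ *-congʳ cd≈1 ⟩
    1# * (u * v)       ≈⟨ *-identityˡ (u * v) ⟩
    u * v              ∎

  -- The field's `_^_` is the library's exponentiation by repeated
  -- multiplication, whose laws we transfer.
  ^-standard : ∀ x n → (x ^ n) ≡ (x Power.^ n)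
  ^-standard x zero = ≡.refl
  ^-standard x (suc n) = ≡.cong (x *_) (^-standard x n)

  ^-congˡ : ∀ {x y} n → x ≈ y → (x ^ n) ≈ (y ^ n)
  ^-congˡ {x} {y} n x≈y rewrite ^-standard x n | ^-standard y n = Power.^-congˡ n x≈y

  ^-distrib-* : ∀ x y n → ((x * y) ^ n) ≈ ((x ^ n) * (y ^ n))
  ^-distrib-* x y n rewrite ^-standard (x * y) n | ^-standard x n | ^-standard y n =
    Power.^-distrib-* x y n

  ^-assocʳ : ∀ x m n → ((x ^ m) ^ n) ≈ (x ^ (m *ℕ n))
  ^-assocʳ x m n rewrite ^-standard (x ^ m) n | ^-standard x m | ^-standard x (m *ℕ n) =
    Power.^-assocʳ x m n

  ^-one : ∀ n → (1# ^ n) ≈ 1#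
  ^-one zero = refl
  ^-one (suc n) = trans (*-identityˡ (1# ^ n)) (^-one n)

  ^-inverse : ∀ {x y} n → (x * y) ≈ 1# → ((x ^ n) * (y ^ n)) ≈ 1#
  ^-inverse {x} {y} n xy≈1 = begin
    (x ^ n) * (y ^ n)  ≈⟨ ^-distrib-* x y n ⟨
    (x * y) ^ n        ≈⟨ ^-congˡ n xy≈1 ⟩
    1# ^ n             ≈⟨ ^-one n ⟩
    1#                 ∎

  unscale : ∀ {t u a a'} → (u * t) ≈ 1# → a' ≈ (t * a) → a ≈ (u * a')
  unscale {t} {u} {a} {a'} ut≈1 a'≈ta = begin
    a            ≈⟨ *-identityˡ a ⟨
    1# * a       ≈⟨ *-congʳ ut≈1 ⟨
    (u * t) * a  ≈⟨ *-assoc u t a ⟩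
    u * (t * a)  ≈⟨ *-congˡ a'≈ta ⟨
    u * a'       ∎

  Proportional-sym : Symmetric Proportional
  Proportional-sym {x , y , z} (t , t≉0 , x'≈ , y'≈ , z'≈)
    with u , tu≈1 ← inverse t t≉0 =
    u , unit-≉0 tu≈1 , unscale ut≈1 x'≈ , unscale ut≈1 y'≈ , unscale ut≈1 z'≈
    where ut≈1 = trans (*-comm u t) tu≈1

  Proportional-trans : Transitive Proportional
  Proportional-trans {x , y , z} (t , t≉0 , x'≈ , y'≈ , z'≈) (s , s≉0 , x''≈ , y''≈ , z''≈) =
    s * t , st≉0 , compose x'≈ x''≈ , compose y'≈ y''≈ , compose z'≈ z''≈
    where
    st≉0 : ¬ ((s * t) ≈ 0#)
    st≉0 st≈0 with v , tv≈1 ← inverse t t≉0 = s≉0 (begin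
      s            ≈⟨ *-identityʳ s ⟨
      s * 1#       ≈⟨ *-congˡ tv≈1 ⟨
      s * (t * v)  ≈⟨ *-assoc s t v ⟨
      (s * t) * v  ≈⟨ *-congʳ st≈0 ⟩
      0# * v       ≈⟨ zeroˡ v ⟩
      0#           ∎)
    compose : ∀ {a a' a''} → a' ≈ (t * a) → a'' ≈ (s * a') → a'' ≈ ((s * t) * a)
    compose {a} a'≈ a''≈ = trans a''≈ (trans (*-congˡ a'≈) (sym (*-assoc s t a)))

  record PointInjection (C D : Triple → Set) : Set where
    field
      apply    : Triple → Triple
      nonzero  : ∀ p → NonZero p → NonZero (apply p)
      on-curve : ∀ p → C p → D (apply p)
      reflects : ∀ {p p'} → Proportional (apply p) (apply p') → Proportional p p'

  open Counting Proportional Proportional-sym Proportional-trans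

  point-count-≤ : ∀ {C D R S} → PointInjection C D → IsPointList C R → IsPointList D S →
                  length R ≤ length S
  point-count-≤ {R = R} {S} ι R-points S-points =
    ≡.subst (_≤ length S) (length-map apply R)
      (length-≤ S (AllPairsProperties.map⁺ (AllPairs.map (λ p≁p' hp∼hp' → p≁p' (reflects hp∼hp'))
                                               R.inequivalent))
                  (AllProperties.map⁺ (All.map (λ {p} (p≉0 , Cp) →
                     S.covers (apply p) (nonzero p p≉0) (on-curve p Cp)) R.onCurve)))
    where
    open PointInjection ι
    module R = IsPointList R-points
    module S = IsPointList S-points

  scale : Carrier → Carrier → Triple → Triple
  scale c d (x , y , z) = (c * x , d * y , z)

  scaling-injection : ∀ q {a b c d} → (c * d) ≈ 1# → (d ^ q) ≈ d → (b * (c ^ 2)) ≈ a →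
                      PointInjection (Curve q a) (Curve q b)
  scaling-injection q {a} {b} {c} {d} cd≈1 dq≈d bc²≈a = record
    { apply    = scale c d
    ; nonzero  = λ { (x , y , z) p≉0 (cx≈0 , dy≈0 , z≈0) →
                       p≉0 (cancel-zero dc≈1 cx≈0 , cancel-zero cd≈1 dy≈0 , z≈0) }
    ; on-curve = maps-curve
    ; reflects = λ { {x , y , z} (t , t≉0 , cx'≈ , dy'≈ , z'≈) →
                       t , t≉0 , cancelˡ dc≈1 (trans cx'≈ (x∙yz≈y∙xz t c x))
                               , cancelˡ cd≈1 (trans dy'≈ (x∙yz≈y∙xz t d y)) , z'≈ }
    }
    where
    dc≈1 : (d * c) ≈ 1#
    dc≈1 = trans (*-comm d c) cd≈1

    cancel-zero : ∀ {k u v} → (k * u) ≈ 1# → (u * v) ≈ 0# → v ≈ 0#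
    cancel-zero {k} {u} {v} ku≈1 uv≈0 = cancelˡ ku≈1 (trans uv≈0 (sym (zeroʳ u)))

    maps-curve : ∀ p → Curve q a p → Curve q b (scale c d p)
    maps-curve (x , y , z) on-Ca = begin
      ((c * x) * ((d * y) ^ q)) + (((c * x) * (d * y)) * (z ^ (q ∸ 1)))
        ≈⟨ +-cong (*-congˡ dy^q≈) (*-congʳ (unit-cancels cd≈1 x y)) ⟩
      ((c * x) * (d * (y ^ q))) + ((x * y) * (z ^ (q ∸ 1)))
        ≈⟨ +-congʳ (unit-cancels cd≈1 x (y ^ q)) ⟩
      (x * (y ^ q)) + ((x * y) * (z ^ (q ∸ 1)))
        ≈⟨ on-Ca ⟩
      ((a * (x ^ 2)) * (z ^ (q ∸ 1))) + (z ^ suc q)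
        ≈⟨ +-congʳ (*-congʳ bcx²≈) ⟨
      ((b * ((c * x) ^ 2)) * (z ^ (q ∸ 1))) + (z ^ suc q) ∎
      where
      dy^q≈ : ((d * y) ^ q) ≈ (d * (y ^ q))
      dy^q≈ = trans (^-distrib-* d y q) (*-congʳ dq≈d)
      bcx²≈ : (b * ((c * x) ^ 2)) ≈ (a * (x ^ 2))
      bcx²≈ = begin
        b * ((c * x) ^ 2)        ≈⟨ *-congˡ (^-distrib-* c x 2) ⟩
        b * ((c ^ 2) * (x ^ 2))  ≈⟨ *-assoc b (c ^ 2) (x ^ 2) ⟨
        (b * (c ^ 2)) * (x ^ 2)  ≈⟨ *-congʳ bc²≈a ⟩
        a * (x ^ 2)              ∎

  frobenius-square-root : ∀ h {α} → (α ^ (2 *ℕ h)) ≈ α →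
                          (((α ^ h) ^ 2) ≈ α) × (((α ^ h) ^ (2 *ℕ h)) ≈ (α ^ h))
  frobenius-square-root h {α} α^q≈α = square , fixed
    where
    q = 2 *ℕ h
    square : ((α ^ h) ^ 2) ≈ α
    square = begin
      (α ^ h) ^ 2   ≈⟨ ^-assocʳ α h 2 ⟩
      α ^ (h *ℕ 2)  ≡⟨ ≡.cong (α ^_) (ℕ.*-comm h 2) ⟩
      α ^ q         ≈⟨ α^q≈α ⟩
      α             ∎
    fixed : ((α ^ h) ^ q) ≈ (α ^ h)
    fixed = begin
      (α ^ h) ^ q   ≈⟨ ^-assocʳ α h q ⟩
      α ^ (h *ℕ q)  ≡⟨ ≡.cong (α ^_) (ℕ.*-comm h q) ⟩
      α ^ (q *ℕ h)  ≈⟨ ^-assocʳ α q h ⟨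
      (α ^ q) ^ h   ≈⟨ ^-congˡ h α^q≈α ⟩
      α ^ h         ∎

  -- Point counts of C_α and C_1 agree once α has a square root β fixed by
  -- y ↦ y^q: scale by (β , β⁻¹) one way and by (β⁻¹ , β) the other way.
  point-count-square-root : ∀ q {α β β⁻¹} → (β * β⁻¹) ≈ 1# → (β ^ 2) ≈ α → (β ^ q) ≈ β →
                            ∀ {R S} → IsPointList (Curve q α) R → IsPointList (Curve q 1#) S →
                            length R ≡ length S
  point-count-square-root q {α} {β} {β⁻¹} ββ⁻¹≈1 β²≈α β^q≈β R-points S-points =
    ℕ.≤-antisym
      (point-count-≤ (scaling-injection q ββ⁻¹≈1 β⁻¹^q≈β⁻¹ (trans (*-identityˡ (β ^ 2)) β²≈α))
                     R-points S-points)
      (point-count-≤ (scaling-injection q β⁻¹β≈1 β^q≈β αβ⁻²≈1) S-points R-points)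
    where
    β⁻¹β≈1 : (β⁻¹ * β) ≈ 1#
    β⁻¹β≈1 = trans (*-comm β⁻¹ β) ββ⁻¹≈1
    β⁻¹^q≈β⁻¹ : (β⁻¹ ^ q) ≈ β⁻¹
    β⁻¹^q≈β⁻¹ = inverse-unique (trans (*-congʳ (sym β^q≈β)) (^-inverse q ββ⁻¹≈1)) ββ⁻¹≈1
    αβ⁻²≈1 : (α * (β⁻¹ ^ 2)) ≈ 1#
    αβ⁻²≈1 = trans (*-congʳ (sym β²≈α)) (^-inverse 2 ββ⁻¹≈1)

lemma4 : (L : FiniteField) → (m n : ℕ) → 1 ≤ m → 1 ≤ n →
         let open FiniteField L
         in card ≡ (2 ^ℕ m) ^ℕ n →
            (α : Carrier) → ¬ (α ≈ 0#) → (α ^ (2 ^ℕ m)) ≈ α →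
            (R S : List Triple) →
            IsPointList (Curve (2 ^ℕ m) α) R →
            IsPointList (Curve (2 ^ℕ m) 1#) S →
            length R ≡ length S
lemma4 L (suc m) n _ _ _ α α≉0 α^q≈α R S R-points S-points =
  point-count-square-root (2 ^ℕ suc m) ββ⁻¹≈1 β²≈α β^q≈β R-points S-points
  where
  open FiniteField L
  open Projective L
  h = 2 ^ℕ m
  β = α ^ h
  β²≈α = proj₁ (frobenius-square-root h α^q≈α)
  β^q≈β = proj₂ (frobenius-square-root h α^q≈α)
  β≉0 : ¬ (β ≈ 0#)
  β≉0 β≈0 = α≉0 (trans (sym β²≈α) (trans (*-congʳ β≈0) (zeroˡ (β ^ 1))))
  ββ⁻¹≈1 = proj₂ (inverse β β≉0)
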